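{- For every transition $t$, the transformation graph $G_t$ reflects $t$ (viewed as a sequence of transitions of length one).
   Context: Clocks: $X=\{x_0,\dots,x_n\}$ with reference clock $x_0$. A (standard) valuation is $v:X\to\mathbb{R}_{\ge0}$ with $v(x_0)=0$. A transition $t$ has a guard $g$ (a finite conjunction of atomic constraints $x\sim c$, $x\ne x_0$, $\sim\in\{<,\le,=,\ge,>\}$, $c\in\mathbb{N}$) and reset set $R\subseteq X\setminus\{x_0\}$; $v\xrightarrow{t}_{\delta}v'$ iff $v+\delta\models g$ and $v'=[R](v+\delta)$, where $v+\delta$ adds $\delta\ge0$ to all clocks other than $x_0$ and $[R]$ sets clocks of $R$ to $0$; for sequences $\sigma=t_1\cdots t_k$, $v_0\xrightarrow{\sigma}_\delta v_k$ is the composition of steps with total delay $\delta$. A transformation graph is a weighted digraph with vertices $\{0,\dots,k\}\times X$ and edge weights $(\preccurlyeq,d)$, $\preccurlyeq\in\{<,\le\}$, $d\in\mathbb{Z}$. A loose valuation is $v:X\to\mathbb{R}$ with $v(x_i)\ge v(x_0)$ for all $i$; $\mathit{norm}(v)(x)=v(x)-v(x_0)$. A solution is a sequence of loose valuations $v_0,\dots,v_k$ with $v_p(x_q)-v_i(x_j)\preccurlyeq d$ for every edge $(i,x_j)\to(p,x_q)$ of weight $(\preccurlyeq,d)$. A graph $G$ with $k+1$ columns reflects $\sigma$ if (1) for every solution $v_0,\dots,v_k$ of $G$, $\mathit{norm}(v_0)\xrightarrow{\sigma}_{\delta}\mathit{norm}(v_k)$ with $\delta=v_0(x_0)-v_k(x_0)$;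 and (2) whenever $v_0\xrightarrow{\sigma}_{\delta}v_k$ for standard valuations, there is a solution of $G$ whose first element is $v_0$ and whose last element is the loose valuation $v_k-\delta$ ($x\mapsto v_k(x)-\delta$ for all $x\in X$). $G_t$ for $t=(g,R)$ has vertices $\{0,1,2\}\times X$ and edges: weight $(\le,0)$: $(0,x_0)\to(1,x_0)$; $(0,x_i)\to(1,x_i)$ and $(1,x_i)\to(0,x_i)$ for $x_i\ne x_0$; $(1,x_i)\to(2,x_i)$ and $(2,x_i)\to(1,x_i)$ for all $x_i\notin R$ (including $x_0$); $(1,x_i)\to(2,x_i)$ for $x_i\in R$; $(2,x_0)\to(2,x_i)$ and $(2,x_i)\to(2,x_0)$ for $x_i\in R$. Guard edges: $(1,x_0)\to(1,x_i)$ of weight $(\preccurlyeq,c)$ for every atomic $x_i\preccurlyeq c$ in $g$; $(1,x_i)\to(1,x_0)$ of weight $(<,-c)$ for every $x_i>c$ and $(\le,-c)$ for every $x_i\ge c$ in $g$ (an equality $x_i=c$ counts as both $x_i\le c$ and $x_i\ge c$). -}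

module Defs where

open import Data.Nat as ℕ using (ℕ)
open import Data.Integer as ℤ using (ℤ; +_; -[1+_])
open import Data.Fin as Fin using (Fin; zero; suc)
open import Data.Fin.Subset using (Subset; _∈_; _∉_)
open import Data.Vec using (Vec; []; _∷_; lookup)
open import Data.List using (List; []; _∷_; _++_; map; concatMap; allFin)
open import Data.List.Membership.Propositional as L using ()
open import Data.Product using (Σ; ∃; _×_; _,_)
open import Data.Bool using (Bool; true; false; if_then_else_)
open import Relation.Nullary using (¬_)
open import Relation.Binary.PropositionalEquality using (_≡_; _≢_)
import Algebra.Structures as AS
open import Relation.Binary.Structures using (IsTotalOrder)

-- The paper uses ℝ.  agda-stdlib has no reals, so we quantify over an
-- arbitrary linearly ordered abelian group with a positive unit 1#
-- (ℝ is an instance); natural/integer constants c are interpreted as c·1#.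

record OrderedTime : Set₁ where
  infixl 6 _+_ _-_
  infix 4 _≤_ _<_
  field
    Carrier : Set
    0# 1#   : Carrier
    _+_     : Carrier → Carrier → Carrier
    -_      : Carrier → Carrier
    _≤_     : Carrier → Carrier → Set
    isAbelianGroup : AS.IsAbelianGroup {A = Carrier} _≡_ _+_ 0# -_
    isTotalOrder   : IsTotalOrder _≡_ _≤_
    +-mono-≤       : ∀ {x y} z → x ≤ y → x + z ≤ y + z
    0<1            : ¬ (1# ≤ 0#)

  _-_ : Carrier → Carrier → Carrier
  x - y = x + (- y)

  _<_ : Carrier → Carrier → Set
  x < y = ¬ (y ≤ x)

  fromℕ : ℕ → Carrier
  fromℕ ℕ.zero    = 0#
  fromℕ (ℕ.suc c) = fromℕ c + 1#

  fromℤ : ℤ → Carrier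
  fromℤ (+ c)      = fromℕ c
  fromℤ -[1+ c ]   = - fromℕ (ℕ.suc c)

-- Clocks: X = Fin (suc n), the reference clock x₀ is 'zero',
-- the proper clocks are 'suc i' for i : Fin n.

Clock : ℕ → Set
Clock n = Fin (ℕ.suc n)

x₀ : ∀ {n} → Clock n
x₀ = zero

data Op : Set where
  op< op≤ op= op≥ op> : Op

-- atomic constraint  x_(suc i) ∼ c   (x ≠ x₀, c ∈ ℕ)
record Atom (n : ℕ) : Set where
  constructor atom
  field
    clk : Fin n
    op  : Op
    cst : ℕ

Guard : ℕ → Set
Guard n = List (Atom n)

-- transition t = (g , R),  R ⊆ X ∖ {x₀} given as a subset of the proper clocks
record Transition (n : ℕ) : Set where
  constructor trans
  field
    guard : Guard n
    reset : Subset n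

isReset : ∀ {n} → Subset n → Clock n → Bool
isReset R zero    = false
isReset R (suc i) = lookup R i

data Strictness : Set where
  strict nonstrict : Strictness

record Edge (k n : ℕ) : Set where
  constructor edge
  field
    srcCol : Fin (ℕ.suc k)
    srcClk : Clock n
    tgtCol : Fin (ℕ.suc k)
    tgtClk : Clock n
    rel    : Strictness
    wt     : ℤ

-- a transformation graph: its edge list (the vertex set is Fin (suc k) × Clock n)
Graph : ℕ → ℕ → Set
Graph k n = List (Edge k n)

c0 c1 c2 : Fin 3
c0 = zero
c1 = suc zero
c2 = suc (suc zero)

le0 : ∀ {n} → Fin 3 → Clock n → Fin 3 → Clock n → Edge 2 n
le0 a x b y = edge a x b y nonstrict (+ 0)

structEdgesAt : ∀ {n} → Subset n → Clock n → List (Edge 2 n)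
structEdgesAt R zero =
  le0 c0 x₀ c1 x₀ ∷ le0 c1 x₀ c2 x₀ ∷ le0 c2 x₀ c1 x₀ ∷ []
structEdgesAt R (suc i) =
  le0 c0 (suc i) c1 (suc i) ∷ le0 c1 (suc i) c0 (suc i) ∷
  (if lookup R i
     then le0 c1 (suc i) c2 (suc i) ∷ le0 c2 x₀ c2 (suc i) ∷ le0 c2 (suc i) c2 x₀ ∷ []
     else le0 c1 (suc i) c2 (suc i) ∷ le0 c2 (suc i) c1 (suc i) ∷ [])

guardEdges : ∀ {n} → Atom n → List (Edge 2 n)
guardEdges (atom i op< c) = edge c1 x₀ c1 (suc i) strict (+ c) ∷ []
guardEdges (atom i op≤ c) = edge c1 x₀ c1 (suc i) nonstrict (+ c) ∷ []
guardEdges (atom i op= c) = edge c1 x₀ c1 (suc i) nonstrict (+ c)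
                          ∷ edge c1 (suc i) c1 x₀ nonstrict (ℤ.- (+ c)) ∷ []
guardEdges (atom i op≥ c) = edge c1 (suc i) c1 x₀ nonstrict (ℤ.- (+ c)) ∷ []
guardEdges (atom i op> c) = edge c1 (suc i) c1 x₀ strict (ℤ.- (+ c)) ∷ []

G : ∀ {n} → Transition n → Graph 2 n
G (trans g R) = concatMap (structEdgesAt R) (allFin _) ++ concatMap guardEdges g

module Semantics (𝕋 : OrderedTime) where
  open OrderedTime 𝕋

  Val : ℕ → Set
  Val n = Clock n → Carrier

  Standard : ∀ {n} → Val n → Set
  Standard v = v x₀ ≡ 0# × (∀ x → 0# ≤ v x)

  _⊕_ : ∀ {n} → Val n → Carrier → Val n
  (v ⊕ δ) zero    = v zero
  (v ⊕ δ) (suc i) = v (suc i) + δ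

  resetVal : ∀ {n} → Subset n → Val n → Val n
  resetVal R v x = if isReset R x then 0# else v x

  sat-op : Op → Carrier → Carrier → Set
  sat-op op< a b = a < b
  sat-op op≤ a b = a ≤ b
  sat-op op= a b = a ≡ b
  sat-op op≥ a b = b ≤ a
  sat-op op> a b = b < a

  _⊨_ : ∀ {n} → Val n → Guard n → Set
  v ⊨ []                 = Data.Unit.⊤ where import Data.Unit
  v ⊨ (atom i op c ∷ g)  = sat-op op (v (suc i)) (fromℕ c) × (v ⊨ g)

  Step : ∀ {n} → Val n → Transition n → Carrier → Val n → Set
  Step v (trans g R) δ v' =
    (0# ≤ δ) × ((v ⊕ δ) ⊨ g) × (∀ x → v' x ≡ resetVal R (v ⊕ δ) x)

  data Run {n} : Val n → List (Transition n) → Carrier → Val n → Set where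
    done : ∀ {v v'} → (∀ x → v' x ≡ v x) → Run v [] 0# v'
    step : ∀ {v u v' t σ δ₁ δ₂} →
           Step v t δ₁ u → Run u σ δ₂ v' → Run v (t ∷ σ) (δ₁ + δ₂) v'

  Loose : ∀ {n} → Val n → Set
  Loose v = ∀ x → v x₀ ≤ v x

  norm : ∀ {n} → Val n → Val n
  norm v x = v x - v x₀

  holds : Strictness → Carrier → Carrier → Set
  holds strict    a b = a < b
  holds nonstrict a b = a ≤ b

  EdgeSat : ∀ {k n} → (Fin (ℕ.suc k) → Val n) → Edge k n → Set
  EdgeSat vs (edge i xj p xq r d) = holds r (vs p xq - vs i xj) (fromℤ d)

  Solution : ∀ {k n} → Graph k n → (Fin (ℕ.suc k) → Val n) → Set
  Solution {k} {n} Gr vs =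
    (∀ i → Loose (vs i)) × (∀ e → e L.∈ Gr → EdgeSat vs e)

  Reflects : ∀ {k n} → Graph k n → List (Transition n) → Set
  Reflects {k} {n} Gr σ =
    (∀ (vs : Fin (ℕ.suc k) → Val n) → Solution Gr vs →
       Run (norm (vs zero)) σ (vs zero x₀ - vs (Fin.fromℕ k) x₀) (norm (vs (Fin.fromℕ k))))
    ×
    (∀ (v₀ vₖ : Val n) (δ : Carrier) → Standard v₀ → Standard vₖ → Run v₀ σ δ vₖ →
       Σ (Fin (ℕ.suc k) → Val n) λ vs →
         Solution Gr vs × (∀ x → vs zero x ≡ v₀ x)
                        × (∀ x → vs (Fin.fromℕ k) x ≡ vₖ x - δ))

-- Read the three columns of G_t as the valuation before the step, after the delay and
-- after the reset, each shifted down by the time elapsed so far, so that x₀ holds minus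
-- that time. The delay is then the drop of x₀ from column 0 to column 2, the guard is a
-- difference constraint between x_i and x₀ in column 1, and a reset clock satisfies
-- x_i = x₀ in column 2. Normalising (subtracting x₀) undoes the shift in both directions.
module Submission where

open import Defs
open import Data.Nat using (ℕ)
open import Data.List using (_∷_; [])

open import Algebra.Bundles using (AbelianGroup)
import Algebra.Properties.AbelianGroup as AbelianGroupProperties
open import Algebra.Structures using (IsAbelianGroup)
open import Data.Bool using (true; false; if_then_else_)
open import Data.Fin using (Fin; zero; suc)
open import Data.Fin.Subset using (Subset)
import Data.Integer as ℤ
import Data.Nat as ℕ
open import Data.List using (concatMap; allFin)
open import Data.List.Relation.Unary.All as All using (All; []; _∷_)
open import Data.List.Relation.Unary.All.Properties
  using (++⁺; ++⁻; concat⁺; concat⁻; map⁺; map⁻; tabulate⁺; tabulate⁻)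
open import Data.Product using (Σ; _×_; _,_; proj₁; proj₂)
open import Data.Unit using (tt)
open import Data.Vec using (lookup)
open import Function using (id; _∘_; _⇔_; mk⇔; Equivalence)
open import Relation.Binary.PropositionalEquality
  using (_≡_; _≗_; refl; sym; cong; cong₂; subst; subst₂; module ≡-Reasoning)
  renaming (trans to ≡-trans)
open import Relation.Binary.Structures using (IsTotalOrder)

open Equivalence using (to; from)

module OrderedTimeProperties (𝕋 : OrderedTime) where
  open OrderedTime 𝕋
  open IsAbelianGroup isAbelianGroup using (assoc; comm; identityˡ; identityʳ; inverseˡ; inverseʳ)
  open IsTotalOrder isTotalOrder public
    using () renaming (trans to ≤-trans; antisym to ≤-antisym; reflexive to ≤-reflexive)
  open ≡-Reasoning

  private
    abelianGroup : AbelianGroup _ _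
    abelianGroup = record { isAbelianGroup = isAbelianGroup }

  open AbelianGroupProperties abelianGroup
    using (ε⁻¹≈ε; ⁻¹-involutive; ⁻¹-anti-homo‿-; //-rightDividesˡ; //-rightDividesʳ)

  x-0≡x : ∀ x → x - 0# ≡ x
  x-0≡x x = ≡-trans (cong (x +_) ε⁻¹≈ε) (identityʳ x)

  x+y-y≡x : ∀ x y → x + y - y ≡ x
  x+y-y≡x x y = //-rightDividesʳ y x

  [x-y]+[y-z]≡x-z : ∀ x y z → (x - y) + (y - z) ≡ x - z
  [x-y]+[y-z]≡x-z x y z = begin
    (x - y) + (y - z)      ≡⟨ assoc x (- y) (y - z) ⟩
    x + (- y + (y - z))    ≡⟨ cong (x +_) (assoc (- y) y (- z)) ⟨
    x + ((- y + y) - z)    ≡⟨ cong (λ w → x + (w - z)) (inverseˡ y) ⟩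
    x + (0# - z)           ≡⟨ cong (x +_) (identityˡ (- z)) ⟩
    x - z                  ∎

  [x-z]-[y-z]≡x-y : ∀ x y z → (x - z) - (y - z) ≡ x - y
  [x-z]-[y-z]≡x-y x y z = begin
    (x - z) - (y - z)      ≡⟨ cong ((x - z) +_) (⁻¹-anti-homo‿- y z) ⟩
    (x - z) + (z - y)      ≡⟨ [x-y]+[y-z]≡x-z x z y ⟩
    x - y                  ∎

  x-y≤0⇒x≤y : ∀ {x y} → x - y ≤ 0# → x ≤ y
  x-y≤0⇒x≤y {x} {y} x-y≤0 = subst₂ _≤_ (//-rightDividesˡ y x) (identityˡ y) (+-mono-≤ y x-y≤0)

  x≤y⇒x-y≤0 : ∀ {x y} → x ≤ y → x - y ≤ 0#
  x≤y⇒x-y≤0 {y = y} x≤y = subst (_ ≤_) (inverseʳ y) (+-mono-≤ (- y) x≤y)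

  x≡y⇒x-y≤0 : ∀ {x y} → x ≡ y → x - y ≤ 0#
  x≡y⇒x-y≤0 = x≤y⇒x-y≤0 ∘ ≤-reflexive

  x≤y⇒0≤y-x : ∀ {x y} → x ≤ y → 0# ≤ y - x
  x≤y⇒0≤y-x {x} x≤y = subst (_≤ _) (inverseʳ x) (+-mono-≤ (- x) x≤y)

  x≤x+y : ∀ {x y} → 0# ≤ y → x ≤ x + y
  x≤x+y {x} {y} 0≤y = subst₂ _≤_ (identityˡ x) (comm y x) (+-mono-≤ x 0≤y)

  x-y≤x : ∀ {x y} → 0# ≤ y → x - y ≤ x
  x-y≤x {x} {y} 0≤y = subst (x - y ≤_) (//-rightDividesˡ y x) (x≤x+y 0≤y)

  -‿antimono-≤ : ∀ {x y} → x ≤ y → - y ≤ - x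
  -‿antimono-≤ {x} {y} x≤y = subst₂ _≤_ x+[-x-y]≡-y y+[-x-y]≡-x (+-mono-≤ (- x - y) x≤y)
    where
    x+[-x-y]≡-y : x + (- x - y) ≡ - y
    x+[-x-y]≡-y = ≡-trans (sym (assoc x (- x) (- y)))
                        (≡-trans (cong (_- y) (inverseʳ x)) (identityˡ (- y)))
    y+[-x-y]≡-x : y + (- x - y) ≡ - x
    y+[-x-y]≡-x = ≡-trans (cong (y +_) (comm (- x) (- y))) (≡-trans (sym (assoc y (- y) (- x)))
                        (≡-trans (cong (_- x) (inverseʳ y)) (identityˡ (- x))))

  -‿cancel-≤ : ∀ {x y} → - x ≤ - y → y ≤ x
  -‿cancel-≤ {x} {y} -x≤-y = subst₂ _≤_ (⁻¹-involutive y) (⁻¹-involutive x) (-‿antimono-≤ -x≤-y)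

  y-x≤-z⇔z≤x-y : ∀ x y z → y - x ≤ - z ⇔ z ≤ x - y
  y-x≤-z⇔z≤x-y x y z = mk⇔
    (λ h → -‿cancel-≤ (subst (_≤ - z) (sym (⁻¹-anti-homo‿- x y)) h))
    (λ h → subst (_≤ - z) (⁻¹-anti-homo‿- x y) (-‿antimono-≤ h))

  y-x<-z⇔z<x-y : ∀ x y z → y - x < - z ⇔ z < x - y
  y-x<-z⇔z<x-y x y z = mk⇔
    (λ h x-y≤z → h (subst (- z ≤_) (⁻¹-anti-homo‿- x y) (-‿antimono-≤ x-y≤z)))
    (λ h -z≤y-x → h (-‿cancel-≤ (subst (- z ≤_) (sym (⁻¹-anti-homo‿- x y)) -z≤y-x)))

  fromℤ-neg : ∀ c → fromℤ (ℤ.- (ℤ.+ c)) ≡ - fromℕ c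
  fromℤ-neg ℕ.zero    = sym ε⁻¹≈ε
  fromℤ-neg (ℕ.suc c) = refl

module _ {ℓ} {n} {P : Edge 2 n → Set ℓ} {g : Guard n} {R : Subset n} where

  All-G⁻ : All P (G (trans g R)) →
           (∀ x → All P (structEdgesAt R x)) × All (All P ∘ guardEdges) g
  All-G⁻ sat with ++⁻ (concatMap (structEdgesAt R) (allFin _)) sat
  ... | structural , guarded =
    tabulate⁻ {f = id} (map⁻ {f = structEdgesAt R} (concat⁻ structural)) ,
    map⁻ {f = guardEdges} (concat⁻ guarded)

  All-G⁺ : (∀ x → All P (structEdgesAt R x)) → All (All P ∘ guardEdges) g →
           All P (G (trans g R))
  All-G⁺ structural guarded =
    ++⁺ (concat⁺ (map⁺ {f = structEdgesAt R} (tabulate⁺ {f = id} structural)))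
        (concat⁺ (map⁺ {f = guardEdges} guarded))

module Reflection (𝕋 : OrderedTime) where
  open OrderedTime 𝕋
  open Semantics 𝕋
  open OrderedTimeProperties 𝕋
  open IsAbelianGroup isAbelianGroup using (identityʳ; inverseʳ)

  ⊨-resp-≗ : ∀ {n} {v w : Val n} (g : Guard n) → v ≗ w → v ⊨ g → w ⊨ g
  ⊨-resp-≗ []                 v≗w tt       = tt
  ⊨-resp-≗ (atom i op c ∷ g) v≗w (s , ss) =
    subst (λ z → sat-op op z (fromℕ c)) (v≗w (suc i)) s , ⊨-resp-≗ g v≗w ss

  resetVal-cong : ∀ {n} (R : Subset n) {v w : Val n} → v ≗ w → resetVal R v ≗ resetVal R w
  resetVal-cong R v≗w x = cong (if isReset R x then 0# else_) (v≗w x)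

  Run-[t]⁺ : ∀ {n} {v v' : Val n} {t δ} → Step v t δ v' → Run v (t ∷ []) δ v'
  Run-[t]⁺ {v' = v'} {t} {δ} s =
    subst (λ δ′ → Run _ (t ∷ []) δ′ v') (identityʳ δ) (step s (done (λ _ → refl)))

  Run-[t]⁻ : ∀ {n} {v v' : Val n} {t δ} → Run v (t ∷ []) δ v' → Step v t δ v'
  Run-[t]⁻ {t = trans g R} (step {δ₁ = δ} (0≤δ , sat , reset) (done v'≗u)) =
    subst (λ δ′ → Step _ (trans g R) δ′ _) (sym (identityʳ δ))
          (0≤δ , sat , λ x → ≡-trans (v'≗u x) (reset x))

  -- Unlike _⊕_ this also moves x₀, so it is invisible after normalisation.
  _⊖_ : ∀ {n} → Val n → Carrier → Val n
  (v ⊖ δ) x = v x - δ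

  norm-⊖ : ∀ {n} (v : Val n) δ → norm (v ⊖ δ) ≗ norm v
  norm-⊖ v δ x = [x-z]-[y-z]≡x-y (v x) (v x₀) δ

  Loose-⊖ : ∀ {n} {v : Val n} δ → Loose v → Loose (v ⊖ δ)
  Loose-⊖ δ loose x = +-mono-≤ (- δ) (loose x)

  Standard⇒Loose : ∀ {n} {v : Val n} → Standard v → Loose v
  Standard⇒Loose (v₀≡0 , 0≤v) x = subst (_≤ _) (sym v₀≡0) (0≤v x)

  norm-Standard : ∀ {n} {v : Val n} → Standard v → norm v ≗ v
  norm-Standard {v = v} (v₀≡0 , _) x = ≡-trans (cong (λ z → v x - z) v₀≡0) (x-0≡x (v x))

  ⊕-Standard : ∀ {n} {v : Val n} {δ} → 0# ≤ δ → Standard v → Standard (v ⊕ δ)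
  ⊕-Standard 0≤δ (v₀≡0 , 0≤v) = v₀≡0 , λ where
    zero    → 0≤v zero
    (suc i) → ≤-trans (0≤v (suc i)) (x≤x+y 0≤δ)

  lowerBoundEdge-sat⇔ : ∀ x y c → y - x ≤ fromℤ (ℤ.- (ℤ.+ c)) ⇔ fromℕ c ≤ x - y
  lowerBoundEdge-sat⇔ x y c rewrite fromℤ-neg c = y-x≤-z⇔z≤x-y x y (fromℕ c)

  strictLowerBoundEdge-sat⇔ : ∀ x y c → y - x < fromℤ (ℤ.- (ℤ.+ c)) ⇔ fromℕ c < x - y
  strictLowerBoundEdge-sat⇔ x y c rewrite fromℤ-neg c = y-x<-z⇔z<x-y x y (fromℕ c)

  guardEdges-sat⇔ : ∀ {n} (vs : Fin 3 → Val n) i op c →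
    All (EdgeSat vs) (guardEdges (atom i op c)) ⇔ sat-op op (norm (vs c1) (suc i)) (fromℕ c)
  guardEdges-sat⇔ vs i op< c = mk⇔ (λ { (e ∷ []) → e }) (_∷ [])
  guardEdges-sat⇔ vs i op≤ c = mk⇔ (λ { (e ∷ []) → e }) (_∷ [])
  guardEdges-sat⇔ vs i op= c = mk⇔
    (λ { (upper ∷ lower ∷ []) → ≤-antisym upper (to (lowerBoundEdge-sat⇔ _ _ c) lower) })
    (λ eq → ≤-reflexive eq ∷ from (lowerBoundEdge-sat⇔ _ _ c) (≤-reflexive (sym eq)) ∷ [])
  guardEdges-sat⇔ vs i op≥ c = mk⇔
    (λ { (e ∷ []) → to (lowerBoundEdge-sat⇔ _ _ c) e })
    (λ s → from (lowerBoundEdge-sat⇔ _ _ c) s ∷ [])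
  guardEdges-sat⇔ vs i op> c = mk⇔
    (λ { (e ∷ []) → to (strictLowerBoundEdge-sat⇔ _ _ c) e })
    (λ s → from (strictLowerBoundEdge-sat⇔ _ _ c) s ∷ [])

  All-guardEdges⇔⊨ : ∀ {n} (vs : Fin 3 → Val n) (g : Guard n) →
    All (All (EdgeSat vs) ∘ guardEdges) g ⇔ norm (vs c1) ⊨ g
  All-guardEdges⇔⊨ vs g = mk⇔ (sat⇒⊨ g) (⊨⇒sat g)
    where
    sat⇒⊨ : ∀ g → All (All (EdgeSat vs) ∘ guardEdges) g → norm (vs c1) ⊨ g
    sat⇒⊨ []                []         = tt
    sat⇒⊨ (atom i op c ∷ g) (sat ∷ sats) = to (guardEdges-sat⇔ vs i op c) sat , sat⇒⊨ g sats

    ⊨⇒sat : ∀ g → norm (vs c1) ⊨ g → All (All (EdgeSat vs) ∘ guardEdges) g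
    ⊨⇒sat []                tt         = []
    ⊨⇒sat (atom i op c ∷ g) (s , ss) = from (guardEdges-sat⇔ vs i op c) s ∷ ⊨⇒sat g ss

  module Soundness {n} (R : Subset n) (vs : Fin 3 → Val n)
                   (structural : ∀ x → All (EdgeSat vs) (structEdgesAt R x)) where
    open ≡-Reasoning

    private
      a b d : Val n
      a = vs c0
      b = vs c1
      d = vs c2

    δ : Carrier
    δ = a x₀ - d x₀

    b₀≤a₀ : b x₀ ≤ a x₀
    b₀≤a₀ with structural zero
    ... | b₀≤a₀ ∷ _ = x-y≤0⇒x≤y b₀≤a₀

    d₀≡b₀ : d x₀ ≡ b x₀
    d₀≡b₀ with structural zero
    ... | _ ∷ d₀≤b₀ ∷ b₀≤d₀ ∷ [] = ≤-antisym (x-y≤0⇒x≤y d₀≤b₀) (x-y≤0⇒x≤y b₀≤d₀)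

    bᵢ≡aᵢ : ∀ i → b (suc i) ≡ a (suc i)
    bᵢ≡aᵢ i with structural (suc i)
    ... | bᵢ≤aᵢ ∷ aᵢ≤bᵢ ∷ _ = ≤-antisym (x-y≤0⇒x≤y bᵢ≤aᵢ) (x-y≤0⇒x≤y aᵢ≤bᵢ)

    0≤δ : 0# ≤ δ
    0≤δ = x≤y⇒0≤y-x (subst (_≤ a x₀) (sym d₀≡b₀) b₀≤a₀)

    norm-delay : norm a ⊕ δ ≗ norm b
    norm-delay zero    = ≡-trans (inverseʳ (a x₀)) (sym (inverseʳ (b x₀)))
    norm-delay (suc i) = begin
      (a (suc i) - a x₀) + (a x₀ - d x₀)  ≡⟨ [x-y]+[y-z]≡x-z _ _ _ ⟩
      a (suc i) - d x₀                    ≡⟨ cong₂ _-_ (sym (bᵢ≡aᵢ i)) d₀≡b₀ ⟩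
      b (suc i) - b x₀                    ∎

    norm-reset : norm d ≗ resetVal R (norm b)
    norm-reset zero = ≡-trans (inverseʳ (d x₀)) (sym (inverseʳ (b x₀)))
    norm-reset (suc i) with lookup R i | structural (suc i)
    ... | true  | _ ∷ _ ∷ _ ∷ dᵢ≤d₀ ∷ d₀≤dᵢ ∷ [] =
      ≡-trans (cong (_- d x₀) (≤-antisym (x-y≤0⇒x≤y dᵢ≤d₀) (x-y≤0⇒x≤y d₀≤dᵢ))) (inverseʳ (d x₀))
    ... | false | _ ∷ _ ∷ dᵢ≤bᵢ ∷ bᵢ≤dᵢ ∷ [] =
      cong₂ _-_ (≤-antisym (x-y≤0⇒x≤y dᵢ≤bᵢ) (x-y≤0⇒x≤y bᵢ≤dᵢ)) d₀≡b₀

  G-sound : ∀ {n} (t : Transition n) (vs : Fin 3 → Val n) → All (EdgeSat vs) (G t) →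
            Step (norm (vs c0)) t (vs c0 x₀ - vs c2 x₀) (norm (vs c2))
  G-sound (trans g R) vs sat with All-G⁻ sat
  ... | structural , guarded =
    0≤δ ,
    ⊨-resp-≗ g (sym ∘ norm-delay) (to (All-guardEdges⇔⊨ vs g) guarded) ,
    λ x → ≡-trans (norm-reset x) (resetVal-cong R (sym ∘ norm-delay) x)
    where open Soundness R vs structural

  module Completeness {n} (g : Guard n) (R : Subset n) {v₀ vₖ : Val n} {δ : Carrier}
                      (v₀-std : Standard v₀) (vₖ-std : Standard vₖ)
                      (run : Step v₀ (trans g R) δ vₖ) where

    0≤δ : 0# ≤ δ
    0≤δ = proj₁ run

    guard-sat : (v₀ ⊕ δ) ⊨ g
    guard-sat = proj₁ (proj₂ run)

    vₖ≡reset : ∀ x → vₖ x ≡ resetVal R (v₀ ⊕ δ) x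
    vₖ≡reset = proj₂ (proj₂ run)

    delayed-std : Standard (v₀ ⊕ δ)
    delayed-std = ⊕-Standard 0≤δ v₀-std

    columns : Fin 3 → Val n
    columns zero             = v₀
    columns (suc zero)       = (v₀ ⊕ δ) ⊖ δ
    columns (suc (suc zero)) = vₖ ⊖ δ

    columns-Loose : ∀ j → Loose (columns j)
    columns-Loose zero             = Standard⇒Loose v₀-std
    columns-Loose (suc zero)       = Loose-⊖ δ (Standard⇒Loose delayed-std)
    columns-Loose (suc (suc zero)) = Loose-⊖ δ (Standard⇒Loose vₖ-std)

    norm-column₁ : norm (columns c1) ≗ v₀ ⊕ δ
    norm-column₁ x = ≡-trans (norm-⊖ (v₀ ⊕ δ) δ x) (norm-Standard delayed-std x)

    column₁≡v₀ : ∀ i → columns c1 (suc i) ≡ v₀ (suc i)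
    column₁≡v₀ i = x+y-y≡x (v₀ (suc i)) δ

    vₖ₀-δ≡v₀₀-δ : vₖ x₀ - δ ≡ v₀ x₀ - δ
    vₖ₀-δ≡v₀₀-δ = cong (_- δ) (≡-trans (proj₁ vₖ-std) (sym (proj₁ v₀-std)))

    structural : ∀ x → All (EdgeSat columns) (structEdgesAt R x)
    structural zero =
      x≤y⇒x-y≤0 (x-y≤x 0≤δ) ∷ x≡y⇒x-y≤0 vₖ₀-δ≡v₀₀-δ ∷ x≡y⇒x-y≤0 (sym vₖ₀-δ≡v₀₀-δ) ∷ []
    structural (suc i) with lookup R i | vₖ≡reset (suc i)
    ... | true  | vₖᵢ≡0 =
      x≡y⇒x-y≤0 (column₁≡v₀ i) ∷ x≡y⇒x-y≤0 (sym (column₁≡v₀ i)) ∷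
      x≤y⇒x-y≤0 (+-mono-≤ (- δ) (subst (_≤ _) (sym vₖᵢ≡0) (proj₂ delayed-std (suc i)))) ∷
      x≡y⇒x-y≤0 vₖᵢ≡vₖ₀ ∷ x≡y⇒x-y≤0 (sym vₖᵢ≡vₖ₀) ∷ []
      where
      vₖᵢ≡vₖ₀ : vₖ (suc i) - δ ≡ vₖ x₀ - δ
      vₖᵢ≡vₖ₀ = cong (_- δ) (≡-trans vₖᵢ≡0 (sym (proj₁ vₖ-std)))
    ... | false | vₖᵢ≡v₀ᵢ+δ =
      x≡y⇒x-y≤0 (column₁≡v₀ i) ∷ x≡y⇒x-y≤0 (sym (column₁≡v₀ i)) ∷
      x≡y⇒x-y≤0 (cong (_- δ) vₖᵢ≡v₀ᵢ+δ) ∷ x≡y⇒x-y≤0 (cong (_- δ) (sym vₖᵢ≡v₀ᵢ+δ)) ∷ []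

    guarded : All (All (EdgeSat columns) ∘ guardEdges) g
    guarded = from (All-guardEdges⇔⊨ columns g) (⊨-resp-≗ g (sym ∘ norm-column₁) guard-sat)

  G-complete : ∀ {n} (t : Transition n) {v₀ vₖ : Val n} {δ} →
    Standard v₀ → Standard vₖ → Step v₀ t δ vₖ →
    Σ (Fin 3 → Val n) λ vs →
      Solution (G t) vs × (∀ x → vs c0 x ≡ v₀ x) × (∀ x → vs c2 x ≡ vₖ x - δ)
  G-complete (trans g R) v₀-std vₖ-std run =
    columns , (columns-Loose , λ _ → All.lookup (All-G⁺ structural guarded)) ,
    (λ _ → refl) , (λ _ → refl)
    where open Completeness g R v₀-std vₖ-std run

lemma5 : (𝕋 : OrderedTime) → (n : ℕ) → (t : Transition n) →
    Semantics.Reflects 𝕋 (G t) (t ∷ [])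
lemma5 𝕋 n t =
  (λ vs (_ , sat) → Run-[t]⁺ (G-sound t vs (All.tabulate (sat _)))) ,
  (λ v₀ vₖ δ v₀-std vₖ-std run → G-complete t v₀-std vₖ-std (Run-[t]⁻ run))
  where open Reflection 𝕋
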